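{- Let $(a_1,\ldots,a_m)$ and $(b_1,\ldots,b_m)$ be integer sequences, each consisting of pairwise distinct elements, and let $k\ge 0$. If $(a_1,\ldots,a_m)$ and $(b_1,\ldots,b_m)$ are order-isomorphic with $k+1$ mismatches, then there exists an integer sequence $(a'_1,\ldots,a'_m)$ such that $(a_1,\ldots,a_m)$ and $(a'_1,\ldots,a'_m)$ are order-isomorphic with $1$ mismatch, and $(a'_1,\ldots,a'_m)$ and $(b_1,\ldots,b_m)$ are order-isomorphic with $k$ mismatches.
   Context: Two integer sequences $(a_1,\ldots,a_m)$ and $(b_1,\ldots,b_m)$ are order-isomorphic with $k$ mismatches if one can select up to $k$ indices $1\le i_1<\ldots<i_k\le m$ such that $a_j\le a_{j'}$ iff $b_j\le b_{j'}$ for all $j,j'\notin\{i_1,\ldots,i_k\}$. -}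

module Defs where

open import Data.Nat using (ℕ) renaming (_≤_ to _≤ℕ_)
open import Data.Integer using (ℤ; _≤_)
open import Data.Fin using (Fin)
open import Data.Fin.Subset using (Subset; _∉_; ∣_∣)
open import Data.Product using (Σ; _×_)
open import Function.Bundles using (_⇔_)
open import Relation.Binary.PropositionalEquality using (_≡_)

Distinct : {m : ℕ} → (Fin m → ℤ) → Set
Distinct {m} a = (i j : Fin m) → a i ≡ a j → i ≡ j

OrderIsoMismatch : {m : ℕ} → ℕ → (Fin m → ℤ) → (Fin m → ℤ) → Set
OrderIsoMismatch {m} k a b =
  Σ (Subset m) λ S → (∣ S ∣ ≤ℕ k) ×
    ((j j′ : Fin m) → j ∉ S → j′ ∉ S → ((a j ≤ a j′) ⇔ (b j ≤ b j′)))

module Submission where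

-- Let S (|S| ≤ k+1) be the mismatch set for a, b.
-- If S is empty, a′ = a works.  Otherwise choose i ∈ S; we make i agree
-- with b by giving a′ a fresh value at position i and leaving the relative
-- order of the remaining entries of a unchanged.  Then a and a′ mismatch at
-- most in {i}, and a′, b mismatch at most in S ─ {i}, of size ≤ k.
--
-- The fresh value must lie above the a-values of the matched positions j ∉ S
-- with b j < b i and below those with b i < b j.  Since a, b are
-- order-isomorphic off S, the first group lies strictly below the second
-- (separation lemma), so an integer c splits them.  Integers may be
-- adjacent, so we double all other entries (an order embedding) and give
-- position i the odd value 2c+1, which lies strictly between the groups.
-- Distinctness of b rules out ties b j = b i with j ≠ i.

open import Defs
open import Data.Nat using (ℕ; zero; suc; z≤n) renaming (_≤_ to _≤ℕ_)
import Data.Nat.Properties as ℕP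
open import Data.Integer using (ℤ; _+_; _≤_; _<_; _≤?_; _<?_; _⊔_; _⊓_; pred; +_) renaming (suc to sucℤ)
import Data.Integer.Properties as ℤP
open import Data.Fin as Fin using (Fin)
import Data.Fin.Properties as FinP
open import Data.Fin.Subset using (Subset; _∈_; _∉_; ∣_∣; ⁅_⁆; _─_; ⊥; Nonempty)
import Data.Fin.Subset.Properties as SubsetP
open import Data.Product using (Σ; _×_; _,_; proj₁; proj₂)
open import Data.Sum using (_⊎_; inj₁; inj₂)
open import Data.Empty using (⊥-elim)
open import Function using (_∘_)
open import Function.Bundles using (_⇔_; mk⇔; Equivalence)
import Function.Properties.Equivalence as ⇔
open import Relation.Nullary using (¬_; yes; no)
open import Relation.Nullary.Decidable using (_×-dec_; ¬?)
open import Level using (0ℓ)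
open import Relation.Unary using (Pred; Decidable)
open import Relation.Binary.PropositionalEquality
  using (_≡_; _≢_; refl; sym; trans; cong; subst)
open import Relation.Binary.Definitions using (tri<; tri≈; tri>)

⇔-both : {A B : Set} → A → B → A ⇔ B
⇔-both a b = mk⇔ (λ _ → b) (λ _ → a)

⇔-neither : {A B : Set} → ¬ A → ¬ B → A ⇔ B
⇔-neither ¬a ¬b = mk⇔ (⊥-elim ∘ ¬a) (⊥-elim ∘ ¬b)

⊔-lub-< : {i j k : ℤ} → i < k → j < k → i ⊔ j < k
⊔-lub-< {i} {j} i<k j<k with ℤP.⊔-sel i j
... | inj₁ i⊔j≡i = subst (_< _) (sym i⊔j≡i) i<k
... | inj₂ i⊔j≡j = subst (_< _) (sym i⊔j≡j) j<k

-- Induction on the index set: adjust the cut of the tail by a max (if the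
-- head is an L-index) or by a min with its predecessor (if an H-index).
separate : ∀ {n} (x : Fin n → ℤ) {L H : Pred (Fin n) 0ℓ} →
  Decidable L → Decidable H →
  (∀ j j′ → L j → H j′ → x j < x j′) →
  Σ ℤ λ c → (∀ j → L j → x j ≤ c) × (∀ j → H j → c < x j)
separate {zero} x L? H? below = + 0 , (λ ()) , (λ ())
separate {suc n} x {L} {H} L? H? below
  with separate (x ∘ Fin.suc) (L? ∘ Fin.suc) (H? ∘ Fin.suc)
                (λ j j′ → below (Fin.suc j) (Fin.suc j′))
... | c , lower , upper with L? Fin.zero | H? Fin.zero
...   | yes l₀ | _ = c ⊔ x₀ , lower′ , upper′
  where
  x₀ = x Fin.zero
  lower′ : ∀ j → L j → x j ≤ c ⊔ x₀
  lower′ Fin.zero    _ = ℤP.i≤j⊔i c x₀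
  lower′ (Fin.suc j) l = ℤP.≤-trans (lower j l) (ℤP.i≤i⊔j c x₀)
  upper′ : ∀ j → H j → c ⊔ x₀ < x j
  upper′ Fin.zero    h = ⊥-elim (ℤP.<-irrefl refl (below Fin.zero Fin.zero l₀ h))
  upper′ (Fin.suc j) h = ⊔-lub-< (upper j h) (below Fin.zero (Fin.suc j) l₀ h)
...   | no ¬l₀ | yes h₀ = c ⊓ pred x₀ , lower′ , upper′
  where
  x₀ = x Fin.zero
  lower′ : ∀ j → L j → x j ≤ c ⊓ pred x₀
  lower′ Fin.zero    l = ⊥-elim (¬l₀ l)
  lower′ (Fin.suc j) l =
    ℤP.⊓-glb (lower j l) (ℤP.i<j⇒i≤pred[j] (below (Fin.suc j) Fin.zero l h₀))
  upper′ : ∀ j → H j → c ⊓ pred x₀ < x j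
  upper′ Fin.zero    _ = ℤP.≤-<-trans (ℤP.i⊓j≤j c _) (ℤP.i≤pred[j]⇒i<j ℤP.≤-refl)
  upper′ (Fin.suc j) h = ℤP.≤-<-trans (ℤP.i⊓j≤i c _) (upper j h)
...   | no ¬l₀ | no ¬h₀ = c , lower′ , upper′
  where
  lower′ : ∀ j → L j → x j ≤ c
  lower′ Fin.zero    l = ⊥-elim (¬l₀ l)
  lower′ (Fin.suc j) l = lower j l
  upper′ : ∀ j → H j → c < x j
  upper′ Fin.zero    h = ⊥-elim (¬h₀ h)
  upper′ (Fin.suc j) h = upper j h

double double+1 : ℤ → ℤ
double x = x + x
double+1 c = c + sucℤ c

double-≤⇔ : (x y : ℤ) → (x ≤ y) ⇔ (double x ≤ double y)
double-≤⇔ x y = mk⇔ (λ x≤y → ℤP.+-mono-≤ x≤y x≤y) reflect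
  where
  reflect : double x ≤ double y → x ≤ y
  reflect 2x≤2y with x ≤? y
  ... | yes x≤y = x≤y
  ... | no x≰y  = let y<x = ℤP.≰⇒> x≰y
                  in ⊥-elim (ℤP.<⇒≱ (ℤP.+-mono-< y<x y<x) 2x≤2y)

i<suc[i] : (i : ℤ) → i < sucℤ i
i<suc[i] i = ℤP.suc[i]≤j⇒i<j ℤP.≤-refl

double-below : {x c : ℤ} → x ≤ c → double x < double+1 c
double-below {x} {c} x≤c =
  ℤP.≤-<-trans (ℤP.+-mono-≤ x≤c x≤c) (ℤP.+-monoʳ-< c (i<suc[i] c))

double-above : {x c : ℤ} → c < x → double+1 c < double x
double-above c<x = ℤP.+-mono-<-≤ c<x (ℤP.i<j⇒suc[i]≤j c<x)

-- Order-isomorphism restricted to the positions satisfying P; by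
-- definition, OrderIsoMismatch k a b = Σ S, ∣ S ∣ ≤ k × OrderIsoOn (_∉ S) a b.
OrderIsoOn : ∀ {m} → Pred (Fin m) 0ℓ → (Fin m → ℤ) → (Fin m → ℤ) → Set
OrderIsoOn P a b = ∀ j j′ → P j → P j′ → (a j ≤ a j′) ⇔ (b j ≤ b j′)

-- Order-isomorphism also transports strict comparisons (no distinctness
-- needed): a j′ ≤ a j would force b j′ ≤ b j.
OrderIsoOn-< : ∀ {m} {P : Pred (Fin m) 0ℓ} {a b : Fin m → ℤ} →
  OrderIsoOn P a b → ∀ {j j′} → P j → P j′ → b j < b j′ → a j < a j′
OrderIsoOn-< iso {j} {j′} pj pj′ bj<bj′ =
  ℤP.≰⇒> (λ aj′≤aj → ℤP.<⇒≱ bj<bj′ (Equivalence.to (iso j′ j pj′ pj) aj′≤aj))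

OrderIsoMismatch-refl : ∀ {m} (k : ℕ) (a : Fin m → ℤ) → OrderIsoMismatch k a a
OrderIsoMismatch-refl {m} k a =
  ⊥ , subst (_≤ℕ k) (sym (SubsetP.∣⊥∣≡0 m)) z≤n , λ _ _ _ _ → ⇔.refl

override : ∀ {m} → Fin m → ℤ → (Fin m → ℤ) → Fin m → ℤ
override i v x j with j FinP.≟ i
... | yes _ = v
... | no _  = x j

override-at : ∀ {m} (i : Fin m) v x → override i v x i ≡ v
override-at i v x with i FinP.≟ i
... | yes _   = refl
... | no i≢i  = ⊥-elim (i≢i refl)

override-else : ∀ {m} {i j : Fin m} v x → j ≢ i → override i v x j ≡ x j
override-else {i = i} {j} v x j≢i with j FinP.≟ i
... | yes j≡i = ⊥-elim (j≢i j≡i)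
... | no _    = refl

placed-between : (x c bⱼ bᵢ : ℤ) → bⱼ ≢ bᵢ →
  (bⱼ < bᵢ → x ≤ c) → (bᵢ < bⱼ → c < x) →
  ((double+1 c ≤ double x) ⇔ (bᵢ ≤ bⱼ)) × ((double x ≤ double+1 c) ⇔ (bⱼ ≤ bᵢ))
placed-between x c bⱼ bᵢ bⱼ≢bᵢ lower upper with ℤP.<-cmp bⱼ bᵢ
... | tri< bⱼ<bᵢ _ _ =
  let 2x<2c+1 = double-below (lower bⱼ<bᵢ) in
  ⇔-neither (ℤP.<⇒≱ 2x<2c+1) (ℤP.<⇒≱ bⱼ<bᵢ) , ⇔-both (ℤP.<⇒≤ 2x<2c+1) (ℤP.<⇒≤ bⱼ<bᵢ)
... | tri≈ _ bⱼ≡bᵢ _ = ⊥-elim (bⱼ≢bᵢ bⱼ≡bᵢ)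
... | tri> _ _ bᵢ<bⱼ =
  let 2c+1<2x = double-above (upper bᵢ<bⱼ) in
  ⇔-both (ℤP.<⇒≤ 2c+1<2x) (ℤP.<⇒≤ bᵢ<bⱼ) , ⇔-neither (ℤP.<⇒≱ 2c+1<2x) (ℤP.<⇒≱ bᵢ<bⱼ)

∉-removal : ∀ {m} {S : Subset m} {i j : Fin m} → j ∉ S ─ ⁅ i ⁆ →
  j ≡ i ⊎ (j ≢ i × j ∉ S)
∉-removal {i = i} {j} j∉S─i with j FinP.≟ i
... | yes j≡i = inj₁ j≡i
... | no j≢i  = inj₂ (j≢i , λ j∈S → j∉S─i (SubsetP.x∈p∧x∉q⇒x∈p─q j∈S (SubsetP.x≢y⇒x∉⁅y⁆ j≢i)))

remove-mismatch : ∀ {m} (a b : Fin m → ℤ) (S : Subset m) {i : Fin m} →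
  Distinct b → i ∈ S → OrderIsoOn (_∉ S) a b →
  Σ (Fin m → ℤ) λ a′ → OrderIsoOn (_∉ ⁅ i ⁆) a a′ × OrderIsoOn (_∉ S ─ ⁅ i ⁆) a′ b
remove-mismatch a b S {i} distinct-b i∈S iso = a′ , iso-a-a′ , iso-a′-b
  where
  Below Above : Pred (Fin _) 0ℓ
  Below j = j ∉ S × b j < b i
  Above j = j ∉ S × b i < b j

  cut : Σ ℤ λ c → (∀ j → Below j → a j ≤ c) × (∀ j → Above j → c < a j)
  cut = separate a (λ j → ¬? (j SubsetP.∈? S) ×-dec (b j <? b i))
                   (λ j → ¬? (j SubsetP.∈? S) ×-dec (b i <? b j))
                   (λ j j′ (j∉S , bj<bi) (j′∉S , bi<bj′) →
                      OrderIsoOn-< iso j∉S j′∉S (ℤP.<-trans bj<bi bi<bj′))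

  c : ℤ
  c = proj₁ cut

  a′ : Fin _ → ℤ
  a′ = override i (double+1 c) (double ∘ a)

  iso-a-a′ : OrderIsoOn (_∉ ⁅ i ⁆) a a′
  iso-a-a′ j j′ j∉i j′∉i
    rewrite override-else (double+1 c) (double ∘ a) (SubsetP.x∉⁅y⁆⇒x≢y j∉i)
          | override-else (double+1 c) (double ∘ a) (SubsetP.x∉⁅y⁆⇒x≢y j′∉i)
    = double-≤⇔ (a j) (a j′)

  versus-i : ∀ {j} → j ≢ i → j ∉ S →
    ((double+1 c ≤ double (a j)) ⇔ (b i ≤ b j)) × ((double (a j) ≤ double+1 c) ⇔ (b j ≤ b i))
  versus-i {j} j≢i j∉S =
    placed-between (a j) c (b j) (b i) (j≢i ∘ distinct-b j i)
      (λ bj<bi → proj₁ (proj₂ cut) j (j∉S , bj<bi))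
      (λ bi<bj → proj₂ (proj₂ cut) j (j∉S , bi<bj))

  iso-a′-b : OrderIsoOn (_∉ S ─ ⁅ i ⁆) a′ b
  iso-a′-b j j′ j∉ j′∉ with ∉-removal {S = S} j∉ | ∉-removal {S = S} j′∉
  ... | inj₁ refl | inj₁ refl = ⇔-both ℤP.≤-refl ℤP.≤-refl
  ... | inj₁ refl | inj₂ (j′≢i , j′∉S)
    rewrite override-at i (double+1 c) (double ∘ a)
          | override-else (double+1 c) (double ∘ a) j′≢i
    = proj₁ (versus-i j′≢i j′∉S)
  ... | inj₂ (j≢i , j∉S) | inj₁ refl
    rewrite override-at i (double+1 c) (double ∘ a)
          | override-else (double+1 c) (double ∘ a) j≢i
    = proj₂ (versus-i j≢i j∉S)
  ... | inj₂ (j≢i , j∉S) | inj₂ (j′≢i , j′∉S)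
    rewrite override-else (double+1 c) (double ∘ a) j≢i
          | override-else (double+1 c) (double ∘ a) j′≢i
    = ⇔.trans (⇔.sym (double-≤⇔ (a j) (a j′))) (iso j j′ j∉S j′∉S)

∣─⁅i⁆∣≤ : ∀ {m k} (S : Subset m) {i : Fin m} → i ∈ S → ∣ S ∣ ≤ℕ suc k →
  ∣ S ─ ⁅ i ⁆ ∣ ≤ℕ k
∣─⁅i⁆∣≤ S {i} i∈S ∣S∣≤1+k = ℕP.≤-pred (ℕP.≤-trans shrinks ∣S∣≤1+k)
  where
  shrinks = SubsetP.p∩q≢∅⇒∣p─q∣<∣p∣ S ⁅ i ⁆ (i , SubsetP.x∈p∩q⁺ (i∈S , SubsetP.x∈⁅x⁆ i))

∣empty∣≤ : ∀ {m} k (S : Subset m) → ¬ Nonempty S → ∣ S ∣ ≤ℕ k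
∣empty∣≤ {m} k S empty =
  subst (_≤ℕ k) (sym (trans (cong ∣_∣ (SubsetP.Empty-unique empty)) (SubsetP.∣⊥∣≡0 m))) z≤n

proposition1 : (m k : ℕ) (a b : Fin m → ℤ) →
    Distinct a → Distinct b →
    OrderIsoMismatch (suc k) a b →
    Σ (Fin m → ℤ) λ a′ → OrderIsoMismatch 1 a a′ × OrderIsoMismatch k a′ b
proposition1 m k a b _ distinct-b (S , ∣S∣≤1+k , iso) with SubsetP.nonempty? S
... | no S-empty =
  a , OrderIsoMismatch-refl 1 a , (S , ∣empty∣≤ k S S-empty , iso)
... | yes (i , i∈S) with remove-mismatch a b S distinct-b i∈S iso
...   | a′ , iso-a-a′ , iso-a′-b =
  a′ , (⁅ i ⁆ , ℕP.≤-reflexive (SubsetP.∣⁅x⁆∣≡1 i) , iso-a-a′)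
     , (S ─ ⁅ i ⁆ , ∣─⁅i⁆∣≤ S i∈S ∣S∣≤1+k , iso-a′-b)
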